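{- Let $\mathcal G=(\mathcal N,\mathcal A,\mathcal R)$ be a first-order grammar, $\sigma$ a substitution, $x_i\in\mathrm{Var}$, $H\in\mathcal T_{\mathcal N}$ with $H\neq x_i$, and $k\in\mathbb N\cup\{\omega\}$. If $x_i\sigma\sim_k H\sigma$, then $\sigma\sim_k\{(x_i,H')\}\sigma_{ -x_i}$.
   Context: Terms: variables $\mathrm{Var}=\{x_1,x_2,\dots\}$, finite set $\mathcal N$ of nonterminals with arities; terms are rooted ordered (possibly infinite) trees labelled in $\mathcal N\cup\mathrm{Var}$ (variable-nodes are leaves, $A$-nodes have $\mathrm{arity}(A)$ ordered successors); $\mathcal T_{\mathcal N}$ is the set of regular terms. Substitutions $\sigma$ have finite support; $x_j\sigma$ denotes $\sigma(x_j)$ and $E\sigma$ replaces each $x_j$ by $x_j\sigma$. Composition $\sigma_1\sigma_2$ is defined by $x_j(\sigma_1\sigma_2)=(x_j\sigma_1)\sigma_2$. $\{(x_i,G)\}$ denotes the substitution mapping $x_i$ to $G$ and fixing all other variables. $\sigma_{ -x_i}$ denotes the substitution with $x_i\sigma_{ -x_i}=x_i$ and $x_j\sigma_{ -x_i}=x_j\sigma$ for $j\neq i$. For a term $H$, $H'$ denotes the regular term $H\{(x_i,H)\}\{(x_i,H)\}\cdots$, i.e. the term presented by the graph obtained from a graph presentation of $H$ by redirecting every arc leading to a node labelled $x_i$ to the root; it satisfies $H'=H\{(x_i,H')\}$. First-order grammar $\mathcal G=(\mathcal N,\mathcal A,\mathcal R)$: finite action set, finite set of rules $A(x_1,\dots,x_m)\xrightarrow{a}E$,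 $m=\mathrm{arity}(A)$, $E$ finite with variables among $x_1,\dots,x_m$. LTS $\mathcal L^{\mathrm{act}}_{\mathcal G}$: states $\mathcal T_{\mathcal N}$, transitions $(A(x_1,\dots,x_m))\tau\xrightarrow{a}E\tau$ for every rule and substitution $\tau$. $\sim_0$ is total; $T\sim_{k+1}U$ iff each $T\xrightarrow{a}T'$ is matched by some $U\xrightarrow{a}U'$ with $T'\sim_kU'$ and vice versa, with the convention $x_j\not\sim_1G$ for every term $G\neq x_j$. $\sim_\omega=\bigcap_k\sim_k$. For substitutions, $\sigma\sim_k\sigma'$ means $x_j\sigma\sim_kx_j\sigma'$ for all $x_j\in\mathrm{Var}$. -}

module Defs where

open import Data.Nat using (ℕ; zero; _≤_) renaming (suc to 1+)
open import Data.Nat.Properties using (_≟_)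
open import Data.Fin using (Fin)
open import Data.Vec using (Vec; []; _∷_; lookup; map)
open import Data.List using (List)
open import Data.List.Membership.Propositional using (_∈_)
open import Data.Product using (Σ; ∃-syntax; _×_; _,_; proj₁; proj₂)
open import Data.Sum using (_⊎_; inj₁; inj₂)
open import Data.Unit using (⊤; tt)
open import Level using (Lift; suc) renaming (zero to ℓ0)
open import Relation.Nullary using (yes; no)
open import Relation.Binary.PropositionalEquality using (_≡_)

-- Variables: x_{j+1} is represented by the natural number j.
-- Nonterminals: Fin n, with arity function ar.
--
-- A (possibly infinite) term is presented by a graph (a coalgebra):
-- a set of nodes S, a labelling of each node either by a variable
-- (a leaf) or by a nonterminal A together with its ar(A) ordered
-- successors, and a root.  The term is the unfolding of the graph
-- from the root.  All notions below (transitions, ~_k) only inspect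
-- the unfolding, so they do not depend on the chosen presentation.
-- Regular terms (T_N) are those presented by a FINITE graph (RTerm).

module _ {n : ℕ} (ar : Fin n → ℕ) where

  data Node (S : Set) : Set where
    var : ℕ → Node S
    app : (A : Fin n) → Vec S (ar A) → Node S

  mapN : ∀ {S S' : Set} → (S → S') → Node S → Node S'
  mapN f (var j) = var j
  mapN f (app A ss) = app A (map f ss)

  record Term : Set₁ where
    constructor term
    field
      St   : Set
      lab  : St → Node St
      root : St

  open Term public

  view : (t : Term) → Node (St t)
  view t = lab t (root t)

  at : (t : Term) → St t → Term
  at t s = term (St t) (lab t) s

  record RTerm : Set where
    constructor rterm
    field
      size  : ℕ
      rlab  : Fin size → Node (Fin size)
      rroot : Fin size

  open RTerm public

  ⟦_⟧ : RTerm → Term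
  ⟦ t ⟧ = term (Fin (size t)) (rlab t) (rroot t)

  varT : ℕ → Term
  varT j = term ⊤ (λ _ → var j) tt

  Subst : Set₁
  Subst = ℕ → Term

  RSubst : Set
  RSubst = ℕ → RTerm

  FiniteSupport : RSubst → Set
  FiniteSupport σ = ∃[ b ] (∀ j → b ≤ j → view ⟦ σ j ⟧ ≡ var j)

  ⟦_⟧ˢ : RSubst → Subst
  ⟦ σ ⟧ˢ j = ⟦ σ j ⟧

  _[_] : Term → Subst → Term
  t [ σ ] = term S' l (inj₁ (root t))
    where
      S' : Set
      S' = St t ⊎ Σ ℕ (λ j → St (σ j))
      l : S' → Node S'
      l (inj₁ s) with lab t s
      ... | var j = mapN (λ u → inj₂ (j , u)) (view (σ j))
      ... | app A ss = app A (map inj₁ ss)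
      l (inj₂ (j , u)) = mapN (λ u' → inj₂ (j , u')) (lab (σ j) u)

  _∘ˢ_ : Subst → Subst → Subst
  (σ₁ ∘ˢ σ₂) j = σ₁ j [ σ₂ ]

  single : ℕ → Term → Subst
  single i G j with j ≟ i
  ... | yes _ = G
  ... | no  _ = varT j

  minus : Subst → ℕ → Subst
  minus σ i j with j ≟ i
  ... | yes _ = varT j
  ... | no  _ = σ j

  prime : ℕ → Term → Term
  prime i H = term (St H) l (root H)
    where
      redirect : St H → St H
      redirect s with lab H s
      ... | var j with j ≟ i
      ...   | yes _ = root H
      ...   | no  _ = s
      redirect s | app _ _ = s
      l : St H → Node (St H)
      l s = mapN redirect (lab H s)

  data FT (V : Set) : Set where
    fvar : V → FT V
    fapp : (A : Fin n) → Vec (FT V) (ar A) → FT V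

  -- E τ where τ maps x_1..x_m to the successors ss of the root of t
  inst : ∀ {m} → FT (Fin m) → (t : Term) → Vec (St t) m → Term
  inst {m} E t ss = term S' l (inj₂ E)
    where
      S' : Set
      S' = St t ⊎ FT (Fin m)
      l : S' → Node S'
      l (inj₁ s) = mapN inj₁ (lab t s)
      l (inj₂ (fvar j)) = mapN inj₁ (lab t (lookup ss j))
      l (inj₂ (fapp A es)) = app A (map inj₂ es)

record Grammar : Set where
  field
    nN    : ℕ
    arity : Fin nN → ℕ
    nA    : ℕ
    -- rule A(x_1..x_m) -a-> E, E finite with variables among x_1..x_m
    rules : List (Σ (Fin nN) λ A → Fin nA × FT arity (Fin (arity A)))

module _ (G : Grammar) where
  open Grammar G

  data Step (T : Term arity) (a : Fin nA) : Term arity → Set₁ where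
    step : ∀ {A ss E} → view arity T ≡ app A ss → (A , a , E) ∈ rules
         → Step T a (inst arity E T ss)

  -- convention x_j ≁_1 G for G ≠ x_j (and symmetrically)
  VarCond : Term arity → Term arity → Set
  VarCond T U = (∀ j → view arity T ≡ var j → view arity U ≡ var j)
              × (∀ j → view arity U ≡ var j → view arity T ≡ var j)

  _∼[_]_ : Term arity → ℕ → Term arity → Set₁
  T ∼[ zero ] U = Lift (suc ℓ0) ⊤
  T ∼[ 1+ k ] U = Lift (suc ℓ0) (VarCond T U)
    × (∀ a T' → Step T a T' → ∃[ U' ] (Step U a U' × T' ∼[ k ] U'))
    × (∀ a U' → Step U a U' → ∃[ T' ] (Step T a T' × T' ∼[ k ] U'))

data ℕω : Set where
  fin : ℕ → ℕω
  ω   : ℕω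

module _ (G : Grammar) where
  open Grammar G

  _∼⟨_⟩_ : Term arity → ℕω → Term arity → Set₁
  T ∼⟨ fin k ⟩ U = _∼[_]_ G T k U
  T ∼⟨ ω ⟩ U = ∀ k → _∼[_]_ G T k U

  _∼ˢ⟨_⟩_ : Subst arity → ℕω → Subst arity → Set₁
  σ ∼ˢ⟨ k ⟩ σ' = ∀ j → σ j ∼⟨ k ⟩ σ' j

-- Write ρ = σ_{-x_i}, T = H σ and U = H' ρ.  For j ≠ i both sides are x_j σ up
-- to unfolding a substituted leaf.  For j = i the claim is x_i σ ∼_k U, proved
-- by induction on ℓ ≤ k: if x_i σ ∼_ℓ U, then T and U have the same root symbol
-- (H ≠ x_i) and below it differ only in that an x_i-leaf of H carries x_i σ in T
-- and the root U in U; hence T ∼_{ℓ+1} U, and x_i σ ∼_{ℓ+1} T gives x_i σ ∼_{ℓ+1} U.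
--
-- "Hence T ∼_{ℓ+1} U" instantiates a general up-to technique for terms given by
-- graphs, developed first: if every pair in a relation R between the nodes of two
-- graphs either carries the same label with pointwise R-related successors or
-- presents ∼_k-equivalent terms, then all R-related nodes present ∼_k-equivalent
-- terms.  Its special case "graph morphisms preserve the presented term" gives
-- the facts about unfolding substitutions.
module Submission where

open import Defs
open import Data.Nat using (ℕ; zero) renaming (suc to 1+)
open import Data.Nat.Properties using (_≟_)
open import Data.Fin using (Fin)
open import Data.Vec using (Vec; []; _∷_; lookup; map)
open import Data.Vec.Relation.Binary.Pointwise.Inductive as Pointwise
  using (Pointwise; []; _∷_; map⁺)
open import Data.Product using (Σ; ∃-syntax; _×_; _,_; proj₁; proj₂)
open import Data.Sum using (_⊎_; inj₁; inj₂; map₂)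
open import Data.Unit using (tt)
open import Data.Empty using (⊥; ⊥-elim)
open import Level using (lift)
open import Relation.Nullary using (¬_; yes; no; Dec)
open import Relation.Binary.PropositionalEquality
  using (_≡_; refl; sym; trans; subst; subst₂; cong)

pointwise-map : ∀ {A B : Set} {R : A → B → Set} {f : A → B} → (∀ x → R x (f x))
              → ∀ {m} (xs : Vec A m) → Pointwise R xs (map f xs)
pointwise-map Rf [] = []
pointwise-map Rf (x ∷ xs) = Rf x ∷ pointwise-map Rf xs

module Equivalence (G : Grammar) where
  open Grammar G

  Tm : Set₁
  Tm = Term arity

  _≈[_]_ : Tm → ℕ → Tm → Set₁
  T ≈[ k ] U = _∼[_]_ G T k U

  ≈-down : ∀ k {T U} → T ≈[ 1+ k ] U → T ≈[ k ] U
  ≈-down zero _ = lift tt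
  ≈-down (1+ k) (vc , fwd , bwd) =
      vc
    , (λ a T' s → let (U' , s' , r) = fwd a T' s in U' , s' , ≈-down k r)
    , (λ a U' s → let (T' , s' , r) = bwd a U' s in T' , s' , ≈-down k r)

  ≈-sym : ∀ k {T U} → T ≈[ k ] U → U ≈[ k ] T
  ≈-sym zero _ = lift tt
  ≈-sym (1+ k) (lift (v₁ , v₂) , fwd , bwd) =
      lift (v₂ , v₁)
    , (λ a U' s → let (T' , s' , r) = bwd a U' s in T' , s' , ≈-sym k r)
    , (λ a T' s → let (U' , s' , r) = fwd a T' s in U' , s' , ≈-sym k r)

  ≈-trans : ∀ k {T U V} → T ≈[ k ] U → U ≈[ k ] V → T ≈[ k ] V
  ≈-trans zero _ _ = lift tt
  ≈-trans (1+ k) (lift (v₁ , v₂) , f₁ , b₁) (lift (w₁ , w₂) , f₂ , b₂) =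
      lift ((λ j e → w₁ j (v₁ j e)) , (λ j e → v₂ j (w₂ j e)))
    , (λ a T' s → let (U' , s' , r) = f₁ a T' s ; (V' , s'' , r') = f₂ a U' s'
                  in V' , s'' , ≈-trans k r r')
    , (λ a V' s → let (U' , s' , r) = b₂ a V' s ; (T' , s'' , r') = b₁ a U' s'
                  in T' , s'' , ≈-trans k r' r)

  ≈-cong : ∀ k {T T' U U'} → T ≈[ k ] T' → U ≈[ k ] U' → T ≈[ k ] U → T' ≈[ k ] U'
  ≈-cong k T≈T' U≈U' T≈U = ≈-trans k (≈-sym k T≈T') (≈-trans k T≈U U≈U')

  data NodeRel {S S' : Set} (R : S → S' → Set) : Node arity S → Node arity S' → Set where
    same-var : ∀ j → NodeRel R (var j) (var j)
    same-app : ∀ A {ss us} → Pointwise R ss us → NodeRel R (app A ss) (app A us)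

  module _ {S S' : Set} {R : S → S' → Set} where

    NodeRel-var : ∀ {n m} → NodeRel R n m
                → (∀ j → n ≡ var j → m ≡ var j) × (∀ j → m ≡ var j → n ≡ var j)
    NodeRel-var (same-var j) = (λ { _ refl → refl }) , (λ { _ refl → refl })
    NodeRel-var (same-app A _) = (λ _ ()) , (λ _ ())

    NodeRel-appˡ : ∀ {n m A ss} → NodeRel R n m → n ≡ app A ss
                 → ∃[ us ] (m ≡ app A us × Pointwise R ss us)
    NodeRel-appˡ (same-app A rs) refl = _ , refl , rs

    NodeRel-appʳ : ∀ {n m A us} → NodeRel R n m → m ≡ app A us
                 → ∃[ ss ] (n ≡ app A ss × Pointwise R ss us)
    NodeRel-appʳ (same-app A rs) refl = _ , refl , rs

    NodeRel-map : ∀ {T T' : Set} {R' : T → T' → Set} {f : S → T} {g : S' → T'}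
                → (∀ {s u} → R s u → R' (f s) (g u))
                → ∀ {n m} → NodeRel R n m → NodeRel R' (mapN arity f n) (mapN arity g m)
    NodeRel-map Rfg (same-var j) = same-var j
    NodeRel-map Rfg (same-app A rs) = same-app A (map⁺ Rfg rs)

  UpToBisim : ℕ → (T U : Tm) → (St T → St U → Set) → Set₁
  UpToBisim k T U R = ∀ s u → R s u
                    → NodeRel R (lab T s) (lab U u) ⊎ (at arity T s ≈[ k ] at arity U u)

  UpToPrinciple : ℕ → Set₁
  UpToPrinciple k = ∀ T U R → UpToBisim k T U R → ∀ s u → R s u → at arity T s ≈[ k ] at arity U u

  UpToBisim-down : ∀ k {T U R} → UpToBisim (1+ k) T U R → UpToBisim k T U R
  UpToBisim-down k bisim s u r = map₂ (≈-down k) (bisim s u r)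

  morphism-≈ : ∀ {k} → UpToPrinciple k → ∀ (T T' : Tm) (f : St T → St T')
             → (∀ x → lab T' (f x) ≡ mapN arity f (lab T x))
             → ∀ x t → lab T' t ≡ mapN arity f (lab T x) → at arity T x ≈[ k ] at arity T' t
  morphism-≈ {k} upto T T' f hom x t = upto T T' Image bisim x t
    where
    Image : St T → St T' → Set
    Image x t = lab T' t ≡ mapN arity f (lab T x)
    image-label : ∀ n → NodeRel Image n (mapN arity f n)
    image-label (var j) = same-var j
    image-label (app A ss) = same-app A (pointwise-map hom ss)
    bisim : UpToBisim k T T' Image
    bisim x t e = inj₁ (subst (NodeRel Image (lab T x)) (sym e) (image-label (lab T x)))

  InstRel : ∀ {m} {T U : Tm} → (St T → St U → Set)
          → St T ⊎ FT arity (Fin m) → St U ⊎ FT arity (Fin m) → Set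
  InstRel R (inj₁ x) (inj₁ y) = R x y
  InstRel R (inj₂ e) (inj₂ e') = e ≡ e'
  InstRel R _ _ = ⊥

  inst-≈ : ∀ {k} → UpToPrinciple k → ∀ (T U : Tm) R → UpToBisim k T U R
         → ∀ {m} (E : FT arity (Fin m)) ss us → Pointwise R ss us
         → inst arity E T ss ≈[ k ] inst arity E U us
  inst-≈ {k} upto T U R bisim {m} E ss us rs = upto T' U' R' bisim' (inj₂ E) (inj₂ E) refl
    where
    T' U' : Tm
    T' = inst arity E T ss
    U' = inst arity E U us
    R' : St T' → St U' → Set
    R' = InstRel {T = T} {U = U} R
    embedˡ : ∀ x t → lab T' t ≡ mapN arity inj₁ (lab T x) → at arity T x ≈[ k ] at arity T' t
    embedˡ = morphism-≈ upto T T' inj₁ (λ _ → refl)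
    embedʳ : ∀ y t → lab U' t ≡ mapN arity inj₁ (lab U y) → at arity U y ≈[ k ] at arity U' t
    embedʳ = morphism-≈ upto U U' inj₁ (λ _ → refl)
    copied : ∀ x y t u → lab T' t ≡ mapN arity inj₁ (lab T x) → lab U' u ≡ mapN arity inj₁ (lab U y)
           → R x y → NodeRel R' (lab T' t) (lab U' u) ⊎ at arity T' t ≈[ k ] at arity U' u
    copied x y t u ex ey r with bisim x y r
    ... | inj₁ nr = inj₁ (subst₂ (NodeRel R') (sym ex) (sym ey) (NodeRel-map (λ r → r) nr))
    ... | inj₂ x≈y = inj₂ (≈-cong k (embedˡ x t ex) (embedʳ y u ey) x≈y)
    bisim' : UpToBisim k T' U' R'
    bisim' (inj₁ x) (inj₁ y) r = copied x y (inj₁ x) (inj₁ y) refl refl r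
    bisim' (inj₂ (fvar j)) (inj₂ .(fvar j)) refl =
      copied (lookup ss j) (lookup us j) (inj₂ (fvar j)) (inj₂ (fvar j)) refl refl (Pointwise.lookup rs j)
    bisim' (inj₂ (fapp A es)) (inj₂ .(fapp A es)) refl =
      inj₁ (same-app A (map⁺ (λ e → e) (Pointwise.refl refl)))

  agreeing-≈ : ∀ {k} → UpToPrinciple k → ∀ (T U : Tm) R → UpToBisim k T U R
             → ∀ s u → NodeRel R (lab T s) (lab U u) → at arity T s ≈[ 1+ k ] at arity U u
  agreeing-≈ {k} upto T U R bisim s u nr = lift (NodeRel-var nr) , forth , back
    where
    forth : ∀ a T' → Step G (at arity T s) a T' → ∃[ U' ] (Step G (at arity U u) a U' × T' ≈[ k ] U')
    forth a _ (step {E = E} e rule) =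
      let (us , e' , rs) = NodeRel-appˡ nr e
      in _ , step e' rule , inst-≈ upto (at arity T s) (at arity U u) R bisim E _ us rs
    back : ∀ a U' → Step G (at arity U u) a U' → ∃[ T' ] (Step G (at arity T s) a T' × T' ≈[ k ] U')
    back a _ (step {E = E} e rule) =
      let (ss , e' , rs) = NodeRel-appʳ nr e
      in _ , step e' rule , inst-≈ upto (at arity T s) (at arity U u) R bisim E ss _ rs

  up-to-principle : ∀ k → UpToPrinciple k
  up-to-principle zero T U R bisim s u r = lift tt
  up-to-principle (1+ k) T U R bisim s u r with bisim s u r
  ... | inj₂ s≈u = s≈u
  ... | inj₁ nr = agreeing-≈ (up-to-principle k) T U R (UpToBisim-down k {T} {U} {R} bisim) s u nr

  subst-lab-app : ∀ (E : Tm) (τ : Subst arity) g {A ss} → lab E g ≡ app A ss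
                → lab (_[_] arity E τ) (inj₁ g) ≡ app A (map inj₁ ss)
  subst-lab-app E τ g e with lab E g
  subst-lab-app E τ g refl | ._ = refl

  subst-lab-var : ∀ (E : Tm) (τ : Subst arity) g {j} → lab E g ≡ var j
                → lab (_[_] arity E τ) (inj₁ g) ≡ mapN arity (λ u → inj₂ (j , u)) (view arity (τ j))
  subst-lab-var E τ g e with lab E g
  subst-lab-var E τ g refl | ._ = refl

  subst-leaf : ∀ k (E : Tm) (τ : Subst arity) g {j} → lab E g ≡ var j
             → τ j ≈[ k ] at arity (_[_] arity E τ) (inj₁ g)
  subst-leaf k E τ g {j} e =
    morphism-≈ (up-to-principle k) (τ j) (_[_] arity E τ) (λ u → inj₂ (j , u)) (λ _ → refl)
      (root (τ j)) (inj₁ g) (subst-lab-var E τ g e)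

  single-≡ : ∀ i (H : Tm) → single arity i H i ≡ H
  single-≡ i H with i ≟ i
  ... | yes _ = refl
  ... | no i≢i = ⊥-elim (i≢i refl)

  single-≢ : ∀ i (H : Tm) j → ¬ j ≡ i → single arity i H j ≡ varT arity j
  single-≢ i H j j≢i with j ≟ i
  ... | yes j≡i = ⊥-elim (j≢i j≡i)
  ... | no _ = refl

  minus-≢ : ∀ (σ : Subst arity) i j → ¬ j ≡ i → minus arity σ i j ≡ σ j
  minus-≢ σ i j j≢i with j ≟ i
  ... | yes j≡i = ⊥-elim (j≢i j≡i)
  ... | no _ = refl

  untouched-≈ : ∀ k (σ : Subst arity) i (P : Tm) j → ¬ j ≡ i
              → σ j ≈[ k ] _∘ˢ_ arity (single arity i P) (minus arity σ i) j
  untouched-≈ k σ i P j j≢i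
    rewrite single-≢ i P j j≢i | sym (minus-≢ σ i j j≢i) =
    subst-leaf k (varT arity j) (minus arity σ i) tt refl

  module Redirection (i : ℕ) (H : Tm) where

    -- u is where an arc into the node t of H points in H'.
    Redirected : St H → St H → Set
    Redirected t u = (¬ lab H t ≡ var i × u ≡ t) ⊎ (lab H t ≡ var i × u ≡ root H)

    -- The labels of H' are those of H with successors redirected; the redirection
    -- is local to the definition of prime, so it is recovered by unification.
    prime-arcs : Σ (St H → St H) λ r → ∀ s → lab (prime arity i H) s ≡ mapN arity r (lab H s)
    prime-arcs = _ , λ s → refl

    redirect : St H → St H
    redirect = proj₁ prime-arcs

    redirect-spec : ∀ t → Redirected t (redirect t)
    redirect-spec t with lab H t
    ... | app A ss = inj₁ ((λ ()) , refl)
    ... | var j with j ≟ i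
    ...   | yes refl = inj₂ (refl , refl)
    ...   | no j≢i = inj₁ ((λ { refl → j≢i refl }) , refl)

    prime-lab : ∀ s {n} → lab H s ≡ n → lab (prime arity i H) s ≡ mapN arity redirect n
    prime-lab s e = trans (proj₂ prime-arcs s) (cong (mapN arity redirect) e)

  node-cases : ∀ {S} (n : Node arity S) → (∃[ j ] n ≡ var j) ⊎ (∃[ B ] ∃[ ss ] n ≡ app B ss)
  node-cases (var j) = inj₁ (j , refl)
  node-cases (app B ss) = inj₂ (B , ss , refl)

  module Unfolding (σ : Subst arity) (i : ℕ) (H : Tm) (H≢xᵢ : ¬ view arity H ≡ var i) where
    open Redirection i H

    ρ : Subst arity
    ρ = minus arity σ i

    T U : Tm
    T = _[_] arity H σ
    U = _[_] arity (prime arity i H) ρ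

    -- A node of H in T is related to the node its incoming arcs point to in H'.
    Rel : St T → St U → Set
    Rel (inj₁ h) (inj₁ h') = Redirected h h'
    Rel _ _ = ⊥

    app-node : ∀ h {B ts} → lab H h ≡ app B ts → NodeRel Rel (lab T (inj₁ h)) (lab U (inj₁ h))
    app-node h e =
      subst₂ (NodeRel Rel) (sym (subst-lab-app H σ h e))
        (sym (subst-lab-app (prime arity i H) ρ h (prime-lab h e)))
        (same-app _ (map⁺ (λ r → r) (pointwise-map redirect-spec _)))

    var-node : ∀ k h {j} → lab H h ≡ var j → ¬ j ≡ i → at arity T (inj₁ h) ≈[ k ] at arity U (inj₁ h)
    var-node k h {j} e j≢i =
      ≈-trans k (≈-sym k (subst-leaf k H σ h e))
        (subst (λ X → X ≈[ k ] at arity U (inj₁ h)) (minus-≢ σ i j j≢i)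
          (subst-leaf k (prime arity i H) ρ h (prime-lab h e)))

    Rel-bisim : ∀ ℓ → σ i ≈[ ℓ ] U → UpToBisim ℓ T U Rel
    Rel-bisim ℓ σᵢ≈U (inj₁ h) (inj₁ .(root H)) (inj₂ (e , refl)) =
      inj₂ (≈-trans ℓ (≈-sym ℓ (subst-leaf ℓ H σ h e)) σᵢ≈U)
    Rel-bisim ℓ σᵢ≈U (inj₁ h) (inj₁ .h) (inj₁ (h≢xᵢ , refl)) with node-cases (lab H h)
    ... | inj₁ (j , e) = inj₂ (var-node ℓ h e λ { refl → h≢xᵢ e })
    ... | inj₂ (B , ts , e) = inj₁ (app-node h e)

    -- Given x_i σ ∼_ℓ U, T ∼_{ℓ+1} U: the roots agree since H ≠ x_i.
    T≈U : ∀ ℓ → σ i ≈[ ℓ ] U → T ≈[ 1+ ℓ ] U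
    T≈U ℓ σᵢ≈U with node-cases (view arity H)
    ... | inj₁ (j , e) = var-node (1+ ℓ) (root H) e λ { refl → H≢xᵢ e }
    ... | inj₂ (B , ts , e) = agreeing-≈ (up-to-principle ℓ) T U Rel (Rel-bisim ℓ σᵢ≈U)
                       (inj₁ (root H)) (inj₁ (root H)) (app-node (root H) e)

    σᵢ≈U : ∀ ℓ → σ i ≈[ ℓ ] T → σ i ≈[ ℓ ] U
    σᵢ≈U zero _ = lift tt
    σᵢ≈U (1+ ℓ) σᵢ≈T = ≈-trans (1+ ℓ) σᵢ≈T (T≈U ℓ (σᵢ≈U ℓ (≈-down ℓ σᵢ≈T)))

  levelwise : ∀ {X Y X' Y'} → (∀ ℓ → X ≈[ ℓ ] Y → X' ≈[ ℓ ] Y')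
            → ∀ k → _∼⟨_⟩_ G X k Y → _∼⟨_⟩_ G X' k Y'
  levelwise f (fin k) X≈Y = f k X≈Y
  levelwise f ω X≈Y ℓ = f ℓ (X≈Y ℓ)

  all-levels : ∀ {X Y} → (∀ ℓ → X ≈[ ℓ ] Y) → ∀ k → _∼⟨_⟩_ G X k Y
  all-levels f (fin k) = f k
  all-levels f ω = f

  -- Proposition 7 for arbitrary (not necessarily regular) terms and substitutions.
  unfolding-≈ : ∀ (σ : Subst arity) i (H : Tm) → ¬ view arity H ≡ var i → ∀ k
              → _∼⟨_⟩_ G (σ i) k (_[_] arity H σ)
              → _∼ˢ⟨_⟩_ G σ k (_∘ˢ_ arity (single arity i (prime arity i H)) (minus arity σ i))
  unfolding-≈ σ i H H≢xᵢ k σᵢ∼T j = by-cases j (j ≟ i)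
    where
    P : Tm
    P = prime arity i H
    by-cases : ∀ j → Dec (j ≡ i) → _∼⟨_⟩_ G (σ j) k (_∘ˢ_ arity (single arity i P) (minus arity σ i) j)
    by-cases .i (yes refl) =
      subst (λ X → _∼⟨_⟩_ G (σ i) k (_[_] arity X (minus arity σ i))) (sym (single-≡ i P))
        (levelwise (Unfolding.σᵢ≈U σ i H H≢xᵢ) k σᵢ∼T)
    by-cases j (no j≢i) = all-levels (λ ℓ → untouched-≈ ℓ σ i P j j≢i) k

open Grammar

proposition7 : (G : Grammar) (σ : RSubst (arity G)) (i : ℕ) (H : RTerm (arity G)) (k : ℕω)
    → FiniteSupport (arity G) σ
    → ¬ (view (arity G) (⟦_⟧ (arity G) H) ≡ var i)
    → _∼⟨_⟩_ G (⟦_⟧ˢ (arity G) σ i) k (_[_] (arity G) (⟦_⟧ (arity G) H) (⟦_⟧ˢ (arity G) σ))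
    → _∼ˢ⟨_⟩_ G (⟦_⟧ˢ (arity G) σ) k (_∘ˢ_ (arity G) (single (arity G) i (prime (arity G) i (⟦_⟧ (arity G) H))) (minus (arity G) (⟦_⟧ˢ (arity G) σ) i))
proposition7 G σ i H k _ H≢xᵢ =
  Equivalence.unfolding-≈ G (⟦_⟧ˢ (arity G) σ) i (⟦_⟧ (arity G) H) H≢xᵢ k
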